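{- Let $s$ and $k$ be positive integers and $T_1,T_2$ rooted trees. If Duplicator has a winning strategy in $\mathrm{ehr}[T_1,T_2,s;k]$, then for all integers $1\leq i_1,\dots,i_s\leq k$ Duplicator has a winning strategy in $\mathrm{ehr}_w[T_1,T_2;i_1,\dots,i_s]$.
   Context: Rooted trees $T_1$ (root $R_1$), $T_2$ (root $R_2$) are directed from parent to child; $\pi(y)=x$ means $x$ is the parent of $y$. In each round of the games below, Spoiler chooses a vertex of one tree and Duplicator then chooses a vertex of the other tree; $x_i\in V(T_1)$, $y_i\in V(T_2)$ denote the vertices chosen in round $i$, with $x_0=R_1$, $y_0=R_2$. Duplicator wins if for all indices $i,j$ (including $0$) of the rounds played: $\pi(x_j)=x_i\Leftrightarrow\pi(y_j)=y_i$ and $x_i=x_j\Leftrightarrow y_i=y_j$. $\mathrm{ehr}[T_1,T_2,s;k]$: $sk$ rounds in $s$ consecutive batches of $k$ rounds; Spoiler chooses a starting tree, plays the whole first batch in it, the next batch in the other tree, and so on, switching trees exactly after each batch. $\mathrm{ehr}_w[T_1,T_2;i_1,\dots,i_s]$: $i_1+\dots+i_s$ rounds, with $i_1,\dots,i_s$ known to both players in advance; Spoiler chooses a starting tree and plays the first $i_1$ rounds in it, the next $i_2$ rounds in the other tree, and so on, switching trees exactly after rounds $i_1$, $i_1+i_2$, $\dots$, $i_1+\dots+i_{s-1}$. -}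

module Defs where

open import Data.Nat using (ℕ; zero; suc)
open import Data.Fin using (Fin)
open import Data.Maybe using (Maybe; just; nothing; _>>=_)
open import Data.List using (List; []; _∷_; _++_; replicate)
open import Data.List.Membership.Propositional using (_∈_)
open import Data.Product using (Σ; ∃; _×_; _,_)
open import Relation.Binary.PropositionalEquality using (_≡_; _≢_)
open import Function.Bundles using (_⇔_)

climb : ∀ {n} → (Fin n → Maybe (Fin n)) → ℕ → Maybe (Fin n) → Maybe (Fin n)
climb p zero    mv = mv
climb p (suc m) mv = climb p m (mv >>= p)

-- A finite rooted tree on vertex set Fin size, given by its parent map:
-- parent v ≡ just x  means  π(v) = x.  The root has no parent, every other
-- vertex has one, and every vertex reaches the root by iterating π
-- (so the parent graph is acyclic and connected).
record RootedTree : Set where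
  field
    size         : ℕ
    root         : Fin size
    parent       : Fin size → Maybe (Fin size)
    root-orphan  : parent root ≡ nothing
    has-parent   : ∀ v → v ≢ root → ∃ λ x → parent v ≡ just x
    reaches-root : ∀ v → ∃ λ m → climb parent m (just v) ≡ just root

  V : Set
  V = Fin size

  IsParent : V → V → Set
  IsParent x y = parent y ≡ just x

open RootedTree

-- Which tree Spoiler plays in during a round.
data Side : Set where
  first second : Side

other : Side → Side
other first  = second
other second = first

batches : Side → List ℕ → List Side
batches σ []       = []
batches σ (i ∷ is) = replicate i σ ++ batches (other σ) is

module _ (T₁ T₂ : RootedTree) where

  Pos : Set
  Pos = List (V T₁ × V T₂)

  Good : Pos → Set
  Good ps = ∀ {x y x′ y′} →
            (x , y) ∈ ((root T₁ , root T₂) ∷ ps) →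
            (x′ , y′) ∈ ((root T₁ , root T₂) ∷ ps) →
            (IsParent T₁ x x′ ⇔ IsParent T₂ y y′) × ((x ≡ x′) ⇔ (y ≡ y′))

  -- Duplicator has a winning strategy from position ps when the remaining
  -- rounds are played according to the schedule.  A strategy may depend on
  -- the whole history (recorded in ps).
  DupWins : List Side → Pos → Set
  DupWins []             ps = Good ps
  DupWins (first  ∷ sch) ps = ∀ (x : V T₁) → Σ (V T₂) λ y → DupWins sch ((x , y) ∷ ps)
  DupWins (second ∷ sch) ps = ∀ (y : V T₂) → Σ (V T₁) λ x → DupWins sch ((x , y) ∷ ps)

  -- Spoiler chooses the starting tree, so Duplicator must win for both choices.
  -- ehr_w[T₁,T₂; i₁,…,i_s]
  DupWinsEhrW : List ℕ → Set
  DupWinsEhrW is = DupWins (batches first is) [] × DupWins (batches second is) []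

  DupWinsEhr : ℕ → ℕ → Set
  DupWinsEhr s k = DupWinsEhrW (replicate s k)

-- The schedule of ehr_w[T₁,T₂; i₁,…,i_s] is a sublist of the schedule of
-- ehr[T₁,T₂,s;k] (same starting tree, batch j shortened from k to i_j rounds).
-- Duplicator plays the shorter game by simulating the longer one: in each
-- round of the longer game that is absent from the shorter one she lets
-- Spoiler pick the root, answers with her strategy and forgets the pair.
-- The winning condition only constrains pairs, so a final position whose
-- pairs all occur in the simulated winning position is itself winning.
module Submission where

open import Defs
open import Data.Nat using (ℕ; zero; suc; _≤_; z≤n; s≤s)
open import Data.Product using (_×_; _,_; proj₂)
open import Data.Vec using (Vec; toList; []; _∷_)
open import Data.Vec.Relation.Unary.All using (All; []; _∷_; map)
open import Data.List using ([]; _∷_; replicate)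
open import Data.List.Relation.Binary.Sublist.Propositional
  using ([]; _∷ʳ_; _∷_) renaming (_⊆_ to _⊑_)
open import Data.List.Relation.Binary.Sublist.Propositional.Properties
  using (++⁺)
open import Data.List.Relation.Binary.Subset.Propositional using (_⊆_)
open import Data.List.Relation.Binary.Subset.Propositional.Properties
  using (∷⁺ʳ; xs⊆x∷xs; ⊆-refl; ⊆-trans)
open import Relation.Binary.PropositionalEquality using (refl)
open RootedTree

replicate⁺ : ∀ {a} {A : Set a} {m n} (x : A) → m ≤ n → replicate m x ⊑ replicate n x
replicate⁺ {n = zero}  x z≤n     = []
replicate⁺ {n = suc n} x z≤n     = x ∷ʳ replicate⁺ x z≤n
replicate⁺             x (s≤s p) = refl ∷ replicate⁺ x p

batches-shorten : ∀ {s k} σ (is : Vec ℕ s) → All (_≤ k) is →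
                  batches σ (toList is) ⊑ batches σ (replicate s k)
batches-shorten σ []       []         = []
batches-shorten σ (i ∷ is) (i≤k ∷ ps) =
  ++⁺ (replicate⁺ σ i≤k) (batches-shorten (other σ) is ps)

module _ (T₁ T₂ : RootedTree) where

  Good-⊆ : ∀ {ps qs} → ps ⊆ qs → Good T₁ T₂ qs → Good T₁ T₂ ps
  Good-⊆ ps⊆qs good m m′ = good (∷⁺ʳ _ ps⊆qs m) (∷⁺ʳ _ ps⊆qs m′)

  DupWins-⊑ : ∀ {a b} → a ⊑ b → ∀ {ps qs} → ps ⊆ qs →
              DupWins T₁ T₂ b qs → DupWins T₁ T₂ a ps
  DupWins-⊑ []              ps⊆qs win = Good-⊆ ps⊆qs win
  DupWins-⊑ (first  ∷ʳ a⊑b) ps⊆qs win =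
    let (y , win′) = win (root T₁) in DupWins-⊑ a⊑b (⊆-trans ps⊆qs (xs⊆x∷xs _ _)) win′
  DupWins-⊑ (second ∷ʳ a⊑b) ps⊆qs win =
    let (x , win′) = win (root T₂) in DupWins-⊑ a⊑b (⊆-trans ps⊆qs (xs⊆x∷xs _ _)) win′
  DupWins-⊑ (_∷_ {x = first}  refl a⊑b) ps⊆qs win x =
    let (y , win′) = win x in y , DupWins-⊑ a⊑b (∷⁺ʳ _ ps⊆qs) win′
  DupWins-⊑ (_∷_ {x = second} refl a⊑b) ps⊆qs win y =
    let (x , win′) = win y in x , DupWins-⊑ a⊑b (∷⁺ʳ _ ps⊆qs) win′

mainTheorem4 : (s k : ℕ) → 1 ≤ s → 1 ≤ k → (T₁ T₂ : RootedTree) →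
               DupWinsEhr T₁ T₂ s k →
               (is : Vec ℕ s) → All (λ i → (1 ≤ i) × (i ≤ k)) is →
               DupWinsEhrW T₁ T₂ (toList is)
mainTheorem4 s k _ _ T₁ T₂ (win₁ , win₂) is bounds =
    DupWins-⊑ T₁ T₂ (batches-shorten first  is (map proj₂ bounds)) ⊆-refl win₁
  , DupWins-⊑ T₁ T₂ (batches-shorten second is (map proj₂ bounds)) ⊆-refl win₂
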